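{- Let $q>1$ be a prime power, let $v$ and $r$ be integers with $v\geq r\geq 2$, and let $\mathcal{S}$ be a partial $r$-spread in $\operatorname{PG}(v-1,\mathbb{F}_q)$. Let $\mathcal{H}$ be its set of holes, and let $C_{\mathcal{H}}$ be any linear $[n,k]$ code over $\mathbb{F}_q$ associated with $\mathcal{H}$. Then (i) $C_{\mathcal{H}}$ is projective and $q^{r-1}$-divisible; (ii) $n=\frac{q^v-1}{q-1}-|\mathcal{S}|\cdot\frac{q^r-1}{q-1}$ and $k\leq v$.
   Context: A partial $r$-spread in $\operatorname{PG}(v-1,\mathbb{F}_q)$ is a set of $r$-dimensional subspaces of $\mathbb{F}_q^v$ that pairwise intersect only in $\{0\}$. A hole of $\mathcal{S}$ is a point (1-dimensional subspace of $\mathbb{F}_q^v$) not contained in any member of $\mathcal{S}$. A linear $[n,k]$ code associated with a set $\mathcal{H}$ of $n$ points of $\operatorname{PG}(v-1,\mathbb{F}_q)$ is a code generated by a matrix (rows not necessarily linearly independent) whose $n$ columns are nonzero vectors spanning the points of $\mathcal{H}$, one column per point; $k$ is the dimension of the code. A code is $\Delta$-divisible if every codeword has Hamming weight divisible by $\Delta$. A code is projective if the columns of a generating matrix are pairwise projectively distinct (no column is a scalar multiple of another, and none is zero). -}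

module Defs where

open import Data.Nat using (ℕ; zero; suc; _^_; _∸_; _≤_) renaming (_+_ to _+ℕ_; _*_ to _*ℕ_)
open import Data.Nat.Divisibility using (_∣_)
open import Data.Fin using (Fin; zero; suc)
open import Data.Product using (Σ; ∃; _×_; _,_)
open import Relation.Nullary using (¬_; Dec; yes; no)
open import Relation.Binary.PropositionalEquality using (_≡_; _≢_)
open import Function.Bundles using (_↔_)

-- A finite field with exactly q elements (q is then necessarily a prime
-- power > 1).  Equality is propositional.

record FiniteField (q : ℕ) : Set₁ where
  infixl 6 _+_
  infixl 7 _*_
  field
    Carrier : Set
    _+_ _*_ : Carrier → Carrier → Carrier
    -_      : Carrier → Carrier
    0# 1#   : Carrier
    _≟_     : (x y : Carrier) → Dec (x ≡ y)
    +-assoc : ∀ x y z → (x + y) + z ≡ x + (y + z)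
    +-comm  : ∀ x y → x + y ≡ y + x
    +-identityˡ : ∀ x → 0# + x ≡ x
    -‿inverseˡ  : ∀ x → (- x) + x ≡ 0#
    *-assoc : ∀ x y z → (x * y) * z ≡ x * (y * z)
    *-comm  : ∀ x y → x * y ≡ y * x
    *-identityˡ : ∀ x → 1# * x ≡ x
    distribˡ : ∀ x y z → x * (y + z) ≡ (x * y) + (x * z)
    0≢1     : 0# ≢ 1#
    inverse : ∀ x → x ≢ 0# → Σ Carrier (λ y → y * x ≡ 1#)
    enumeration : Fin q ↔ Carrier

module LinearAlgebra {q : ℕ} (F : FiniteField q) where
  open FiniteField F

  Vec : ℕ → Set
  Vec m = Fin m → Carrier

  Σ[_] : ∀ {m} → (Fin m → Carrier) → Carrier
  Σ[_] {zero}  f = 0#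
  Σ[_] {suc m} f = f zero + Σ[ (λ i → f (suc i)) ]

  _≋_ : ∀ {m} → Vec m → Vec m → Set
  x ≋ y = ∀ j → x j ≡ y j

  zeroVec : ∀ {m} → Vec m
  zeroVec _ = 0#

  lincomb : ∀ {k m} → (Fin k → Vec m) → Vec k → Vec m
  lincomb B a j = Σ[ (λ i → a i * B i j) ]

  InSpan : ∀ {k m} → (Fin k → Vec m) → Vec m → Set
  InSpan B x = ∃ λ a → x ≋ lincomb B a

  LinIndep : ∀ {k m} → (Fin k → Vec m) → Set
  LinIndep B = ∀ a → lincomb B a ≋ zeroVec → ∀ i → a i ≡ 0#

  SamePoint : ∀ {m} → Vec m → Vec m → Set
  SamePoint x y = ∃ λ c → (c ≢ 0#) × (∀ j → y j ≡ c * x j)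

  NonZeroVec : ∀ {m} → Vec m → Set
  NonZeroVec x = ¬ (x ≋ zeroVec)

  record Subspace (v r : ℕ) : Set where
    field
      basis : Fin r → Vec v
      indep : LinIndep basis

  Member : ∀ {v r} → Subspace v r → Vec v → Set
  Member U x = InSpan (Subspace.basis U) x

  -- A partial r-spread in PG(v-1,F): a family of s r-dimensional
  -- subspaces pairwise meeting only in {0}.  (Pairwise trivial
  -- intersection forces the members to be distinct, so |S| = s.)
  record PartialSpread (v r s : ℕ) : Set where
    field
      member : Fin s → Subspace v r
      disjoint : ∀ i j → i ≢ j → ∀ x →
                 Member (member i) x → Member (member j) x → x ≋ zeroVec

  IsHole : ∀ {v r s} → PartialSpread v r s → Vec v → Set
  IsHole S x = NonZeroVec x × (∀ i → ¬ Member (PartialSpread.member S i) x)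

  Matrix : ℕ → ℕ → Set
  Matrix v n = Fin v → Fin n → Carrier

  column : ∀ {v n} → Matrix v n → Fin n → Vec v
  column G j i = G i j

  AssociatedWithHoles : ∀ {v r s n} → PartialSpread v r s → Matrix v n → Set
  AssociatedWithHoles {n = n} S G =
      (∀ j → IsHole S (column G j))
    × (∀ x → IsHole S x → ∃ λ j → SamePoint (column G j) x)
    × (∀ j j′ → SamePoint (column G j) (column G j′) → j ≡ j′)

  InCode : ∀ {v n} → Matrix v n → Vec n → Set
  InCode G c = InSpan G c

  weight : ∀ {n} → Vec n → ℕ
  weight {zero}  c = 0
  weight {suc n} c with c zero ≟ 0#
  ... | yes _ = weight (λ j → c (suc j))
  ... | no  _ = suc (weight (λ j → c (suc j)))

  HasDimension : ∀ {v n} → Matrix v n → ℕ → Set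
  HasDimension {n = n} G k =
    Σ (Fin k → Vec n) λ B →
      (∀ i → InCode G (B i)) × LinIndep B × (∀ c → InCode G c → InSpan B c)

  Projective : ∀ {v n} → Matrix v n → Set
  Projective G = (∀ j → NonZeroVec (column G j))
               × (∀ j j′ → j ≢ j′ → ¬ SamePoint (column G j) (column G j′))

  Divisible : ∀ {v n} → ℕ → Matrix v n → Set
  Divisible Δ G = ∀ c → InCode G c → Δ ∣ weight c

-- Every nonzero vector of F^v either spans a hole, and is then a nonzero multiple
-- of exactly one column of G, or lies in exactly one member of the spread, with
-- unique coordinates there. Hence the sum over F^v of any g with g 0 = 0 and
-- g (c y) = g y for c ≠ 0 splits as (q − 1) Σⱼ g (col j) plus the sums of g over the
-- members. For g x = [x ≠ 0] this counts the holes. For g x = [a·x ≠ 0] with a ≠ 0,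
-- since a nonzero linear form on F^m is nonzero at (q − 1) q^(m−1) vectors, it gives
--   q^(v−1) = wt (a G) + T q^(r−1),
-- T being the number of members on which a·x does not vanish identically; so
-- q^(r−1) divides every weight. Finally k ≤ v because a basis of the code pulls back
-- to an injective linear map F^k → F^v.

module Submission where

open import Defs
open import Algebra.Bundles using (CommutativeRing)
open import Algebra.Structures using (IsCommutativeRing)
open import Algebra.Consequences.Propositional
  using (comm∧idˡ⇒id; comm∧invˡ⇒inv; comm∧distrˡ⇒distr; comm∧assoc⇒middleFour)
open import Data.Nat using (ℕ; zero; suc; _^_; _∸_; _≤_; _<_; z≤n; s≤s; NonZero; >-nonZero)
open import Data.Nat.Properties as ℕ using (+-*-semiring)
open import Data.Nat.Divisibility using (_∣_; divides; ∣m+n∣m⇒∣n; n∣m*n; _∣0)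
open import Data.Fin using (Fin; zero; suc)
import Data.Fin.Properties as Fin
open import Data.Vec.Functional using ([]; _∷_; head; tail)
import Data.Vec.Functional.Relation.Binary.Pointwise.Properties as Pointwise
open import Data.Product using (_×_; _,_; proj₁; proj₂; ∃)
open import Data.Empty using (⊥-elim)
open import Function.Base using (id)
open import Function.Bundles using (Inverse; Equivalence; _⇔_; mk⇔)
open import Relation.Nullary using (¬_; Dec; yes; no; ¬?; _×-dec_)
open import Relation.Nullary.Decidable using (map′)
open import Relation.Binary.Core using (_Preserves_⟶_)
open import Relation.Binary.Definitions using (Decidable; _Respects_)
open import Relation.Binary.PropositionalEquality
import Algebra.Properties.CommutativeSemigroup ℕ.*-commutativeSemigroup as ℕ*

module FieldProperties {q : ℕ} (F : FiniteField q) where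
  open FiniteField F
  open ≡-Reasoning

  isCommutativeRing : IsCommutativeRing _≡_ _+_ _*_ -_ 0# 1#
  isCommutativeRing = record
    { isRing = record
      { +-isAbelianGroup = record
        { isGroup = record
          { isMonoid = record
            { isSemigroup = record
              { isMagma = record { isEquivalence = isEquivalence ; ∙-cong = cong₂ _+_ }
              ; assoc = +-assoc }
            ; identity = comm∧idˡ⇒id +-comm +-identityˡ }
          ; inverse = comm∧invˡ⇒inv +-comm -‿inverseˡ
          ; ⁻¹-cong = cong -_ }
        ; comm = +-comm }
      ; *-cong = cong₂ _*_
      ; *-assoc = *-assoc
      ; *-identity = comm∧idˡ⇒id *-comm *-identityˡ
      ; distrib = comm∧distrˡ⇒distr (cong₂ _+_) *-comm distribˡ }
    ; *-comm = *-comm }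

  commutativeRing : CommutativeRing _ _
  commutativeRing = record { isCommutativeRing = isCommutativeRing }

  open CommutativeRing commutativeRing using (ring; *-commutativeSemigroup)
  open CommutativeRing commutativeRing public using (_-_; -‿inverseʳ; zeroˡ; zeroʳ)

  open import Algebra.Properties.CommutativeSemigroup *-commutativeSemigroup public
    using (x∙yz≈y∙xz)
  open import Algebra.Properties.Ring ring public
    using (+-inverseˡ-unique; x∙y⁻¹≈ε⇒x≈y; [y-z]x≈yx-zx)

  inv : (c : Carrier) → c ≢ 0# → Carrier
  inv c c≢0 = proj₁ (inverse c c≢0)

  module _ {c : Carrier} (c≢0 : c ≢ 0#) where

    inv-*-cancel : ∀ x → inv c c≢0 * (c * x) ≡ x
    inv-*-cancel x = begin
      inv c c≢0 * (c * x) ≡⟨ *-assoc _ c x ⟨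
      (inv c c≢0 * c) * x ≡⟨ cong (_* x) (proj₂ (inverse c c≢0)) ⟩
      1# * x              ≡⟨ *-identityˡ x ⟩
      x                   ∎

    *-inv-cancel : ∀ x → c * (inv c c≢0 * x) ≡ x
    *-inv-cancel x = begin
      c * (inv c c≢0 * x) ≡⟨ *-assoc c _ x ⟨
      (c * inv c c≢0) * x ≡⟨ cong (_* x) (trans (*-comm c _) (proj₂ (inverse c c≢0))) ⟩
      1# * x              ≡⟨ *-identityˡ x ⟩
      x                   ∎

    *≡⇔≡inv* : ∀ x y → c * x ≡ y ⇔ x ≡ inv c c≢0 * y
    *≡⇔≡inv* x y = mk⇔
      (λ cx≡y → trans (sym (inv-*-cancel x)) (cong (inv c c≢0 *_) cx≡y))
      (λ x≡c⁻¹y → trans (cong (c *_) x≡c⁻¹y) (*-inv-cancel y))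

    *-cancelˡ-≢0 : ∀ {x y} → c * x ≡ c * y → x ≡ y
    *-cancelˡ-≢0 {x} {y} cx≡cy = trans (Equivalence.to (*≡⇔≡inv* x (c * y)) cx≡cy) (inv-*-cancel y)

    inv-≢0 : inv c c≢0 ≢ 0#
    inv-≢0 c⁻¹≡0 = 0≢1 (begin
      0#               ≡⟨ zeroˡ c ⟨
      0# * c           ≡⟨ cong (_* c) c⁻¹≡0 ⟨
      inv c c≢0 * c    ≡⟨ proj₂ (inverse c c≢0) ⟩
      1#               ∎)

    *-≡0⇔ : ∀ {x} → c * x ≡ 0# ⇔ x ≡ 0#
    *-≡0⇔ {x} = mk⇔ (λ cx≡0 → *-cancelˡ-≢0 (trans cx≡0 (sym (zeroʳ c))))
                    (λ x≡0 → trans (cong (c *_) x≡0) (zeroʳ c))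

    *-≢0 : ∀ {x} → x ≢ 0# → c * x ≢ 0#
    *-≢0 x≢0 cx≡0 = x≢0 (Equivalence.to *-≡0⇔ cx≡0)

  affine-root : ∀ {α} → α ≢ 0# → ∀ β → ∃ λ d → ∀ c → α * c + β ≡ 0# ⇔ c ≡ d
  affine-root α≢0 β = inv _ α≢0 * - β , λ c → mk⇔
    (λ αc+β≡0 → Equivalence.to (*≡⇔≡inv* α≢0 c (- β)) (+-inverseˡ-unique _ β αc+β≡0))
    (λ c≡d → trans (cong (_+ β) (Equivalence.from (*≡⇔≡inv* α≢0 c (- β)) c≡d))
                   (-‿inverseˡ β))

  2≤q : 2 ≤ q
  2≤q = Fin.injective⇒≤ {f = code} code-injective
    where
    code : Fin 2 → Fin q
    code zero    = Inverse.from enumeration 0#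
    code (suc _) = Inverse.from enumeration 1#

    0≡1 : code zero ≡ code (suc zero) → 0# ≡ 1#
    0≡1 e = trans (sym (Inverse.strictlyInverseˡ enumeration 0#))
                  (trans (cong (Inverse.to enumeration) e) (Inverse.strictlyInverseˡ enumeration 1#))

    code-injective : ∀ {i j} → code i ≡ code j → i ≡ j
    code-injective {zero}        {zero}        _ = refl
    code-injective {suc zero}    {suc zero}    _ = refl
    code-injective {zero}        {suc zero}    e = ⊥-elim (0≢1 (0≡1 e))
    code-injective {suc zero}    {zero}        e = ⊥-elim (0≢1 (0≡1 (sym e)))

  q∸1-nonZero : NonZero (q ∸ 1)
  q∸1-nonZero = >-nonZero (ℕ.∸-monoˡ-≤ 1 2≤q)

  q-nonZero : NonZero q
  q-nonZero = >-nonZero (ℕ.≤-trans (s≤s z≤n) 2≤q)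

module Vectors {q : ℕ} (F : FiniteField q) where
  open FiniteField F
  open LinearAlgebra F
  open FieldProperties F
  open ≡-Reasoning

  Σ-cong : ∀ {m} {f g : Fin m → Carrier} → (∀ i → f i ≡ g i) → Σ[ f ] ≡ Σ[ g ]
  Σ-cong {zero}  f≡g = refl
  Σ-cong {suc m} f≡g = cong₂ _+_ (f≡g zero) (Σ-cong (λ i → f≡g (suc i)))

  Σ-zero : ∀ {m} {f : Fin m → Carrier} → (∀ i → f i ≡ 0#) → Σ[ f ] ≡ 0#
  Σ-zero {zero}  f≡0 = refl
  Σ-zero {suc m} f≡0 = trans (cong₂ _+_ (f≡0 zero) (Σ-zero (λ i → f≡0 (suc i)))) (+-identityˡ 0#)

  Σ-distrib-+ : ∀ {m} (f g : Fin m → Carrier) → Σ[ (λ i → f i + g i) ] ≡ Σ[ f ] + Σ[ g ]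
  Σ-distrib-+ {zero}  f g = sym (+-identityˡ 0#)
  Σ-distrib-+ {suc m} f g =
    trans (cong (f zero + g zero +_) (Σ-distrib-+ (λ i → f (suc i)) (λ i → g (suc i))))
          (comm∧assoc⇒middleFour +-comm +-assoc (f zero) (g zero) _ _)

  *-distribˡ-Σ : ∀ {m} c (f : Fin m → Carrier) → c * Σ[ f ] ≡ Σ[ (λ i → c * f i) ]
  *-distribˡ-Σ {zero}  c f = zeroʳ c
  *-distribˡ-Σ {suc m} c f =
    trans (distribˡ c _ _) (cong (c * f zero +_) (*-distribˡ-Σ c (λ i → f (suc i))))

  Σ-comm : ∀ {m n} (f : Fin m → Fin n → Carrier) →
           Σ[ (λ i → Σ[ (λ j → f i j) ]) ] ≡ Σ[ (λ j → Σ[ (λ i → f i j) ]) ]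
  Σ-comm {zero} {n} f = sym (Σ-zero {n} (λ _ → refl))
  Σ-comm {suc m} f = trans (cong (Σ[ f zero ] +_) (Σ-comm (λ i → f (suc i))))
                           (sym (Σ-distrib-+ (f zero) (λ j → Σ[ (λ i → f (suc i) j) ])))

  Σ-neg : ∀ {m} (f : Fin m → Carrier) → Σ[ (λ i → - f i) ] ≡ - Σ[ f ]
  Σ-neg f = +-inverseˡ-unique _ Σ[ f ]
    (trans (sym (Σ-distrib-+ (λ i → - f i) f)) (Σ-zero (λ i → -‿inverseˡ (f i))))

  _≋?_ : ∀ {m} → Decidable (_≋_ {m})
  _≋?_ = Pointwise.decidable {R = _≡_} _≟_

  ≋-sym : ∀ {m} {x y : Vec m} → x ≋ y → y ≋ x
  ≋-sym = Pointwise.sym {R = _≡_} sym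

  ≋-trans : ∀ {m} {x y z : Vec m} → x ≋ y → y ≋ z → x ≋ z
  ≋-trans = Pointwise.trans {R = _≡_} trans

  ≋-zero⇔ : ∀ {m} {x y : Vec m} → x ≋ y → x ≋ zeroVec ⇔ y ≋ zeroVec
  ≋-zero⇔ x≋y = mk⇔ (≋-trans (≋-sym x≋y)) (≋-trans x≋y)

  ∷-≋⇔ : ∀ {m} c (x : Vec m) y → (c ∷ x) ≋ y ⇔ (c ≡ head y × x ≋ tail y)
  ∷-≋⇔ c x y = mk⇔ (λ e → e zero , λ i → e (suc i))
                   (λ { (c≡y₀ , x≋y′) zero → c≡y₀ ; (c≡y₀ , x≋y′) (suc i) → x≋y′ i })

  ∷-congʳ : ∀ {m} {c} {x x′ : Vec m} → x ≋ x′ → (c ∷ x) ≋ (c ∷ x′)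
  ∷-congʳ x≋x′ zero    = refl
  ∷-congʳ x≋x′ (suc i) = x≋x′ i

  head∷tail-≋ : ∀ {m} (y : Vec (suc m)) → (head y ∷ tail y) ≋ y
  head∷tail-≋ y zero    = refl
  head∷tail-≋ y (suc i) = refl

  scale : ∀ {m} → Carrier → Vec m → Vec m
  scale c x j = c * x j

  dot : ∀ {m} → Vec m → Vec m → Carrier
  dot a x = Σ[ (λ i → a i * x i) ]

  dot-comm : ∀ {m} (a x : Vec m) → dot a x ≡ dot x a
  dot-comm a x = Σ-cong (λ i → *-comm (a i) (x i))

  dot-congʳ : ∀ {m} (a : Vec m) {x y : Vec m} → x ≋ y → dot a x ≡ dot a y
  dot-congʳ a x≋y = Σ-cong (λ i → cong (a i *_) (x≋y i))

  dot-zeroˡ : ∀ {m} {a : Vec m} x → a ≋ zeroVec → dot a x ≡ 0#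
  dot-zeroˡ x a≋0 = Σ-zero (λ i → trans (cong (_* x i) (a≋0 i)) (zeroˡ (x i)))

  dot-zeroʳ : ∀ {m} (a : Vec m) {x} → x ≋ zeroVec → dot a x ≡ 0#
  dot-zeroʳ a x≋0 = Σ-zero (λ i → trans (cong (a i *_) (x≋0 i)) (zeroʳ (a i)))

  dot-scaleʳ : ∀ {m} (a x : Vec m) c → dot a (scale c x) ≡ c * dot a x
  dot-scaleʳ a x c = begin
    Σ[ (λ i → a i * (c * x i)) ] ≡⟨ Σ-cong (λ i → x∙yz≈y∙xz (a i) c (x i)) ⟩
    Σ[ (λ i → c * (a i * x i)) ] ≡⟨ *-distribˡ-Σ c (λ i → a i * x i) ⟨
    c * dot a x                  ∎

  dot-lincomb : ∀ {k m} (a : Vec m) (B : Fin k → Vec m) (b : Vec k) →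
                dot a (lincomb B b) ≡ dot (λ t → dot a (B t)) b
  dot-lincomb a B b = begin
    Σ[ (λ u → a u * Σ[ (λ t → b t * B t u) ]) ]
      ≡⟨ Σ-cong (λ u → *-distribˡ-Σ (a u) (λ t → b t * B t u)) ⟩
    Σ[ (λ u → Σ[ (λ t → a u * (b t * B t u)) ]) ]
      ≡⟨ Σ-comm (λ u t → a u * (b t * B t u)) ⟩
    Σ[ (λ t → Σ[ (λ u → a u * (b t * B t u)) ]) ]
      ≡⟨ Σ-cong (λ t → Σ-cong (λ u → x∙yz≈y∙xz (a u) (b t) (B t u))) ⟩
    Σ[ (λ t → Σ[ (λ u → b t * (a u * B t u)) ]) ]
      ≡⟨ Σ-cong (λ t → *-distribˡ-Σ (b t) (λ u → a u * B t u)) ⟨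
    Σ[ (λ t → b t * dot a (B t)) ]
      ≡⟨ dot-comm b (λ t → dot a (B t)) ⟩
    Σ[ (λ t → dot a (B t) * b t) ] ∎

  lincomb-cong : ∀ {k m} (B : Fin k → Vec m) {a b : Vec k} → a ≋ b → lincomb B a ≋ lincomb B b
  lincomb-cong B a≋b j = Σ-cong (λ i → cong (_* B i j) (a≋b i))

  lincomb-congˡ : ∀ {k m} {B C : Fin k → Vec m} → (∀ t → B t ≋ C t) →
                  ∀ a → lincomb B a ≋ lincomb C a
  lincomb-congˡ B≋C a j = Σ-cong (λ t → cong (a t *_) (B≋C t j))

  lincomb-lincomb : ∀ {k l m} (G : Fin l → Vec m) (A : Fin k → Vec l) (b : Vec k) →
                    lincomb G (lincomb A b) ≋ lincomb (λ t → lincomb G (A t)) b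
  lincomb-lincomb G A b j = begin
    dot (lincomb A b) Gⱼ              ≡⟨ dot-comm (lincomb A b) Gⱼ ⟩
    dot Gⱼ (lincomb A b)              ≡⟨ dot-lincomb Gⱼ A b ⟩
    dot (λ t → dot Gⱼ (A t)) b        ≡⟨ dot-comm (λ t → dot Gⱼ (A t)) b ⟩
    dot b (λ t → dot Gⱼ (A t))        ≡⟨ dot-congʳ b (λ t → dot-comm Gⱼ (A t)) ⟩
    dot b (λ t → lincomb G (A t) j)   ∎
    where
    Gⱼ : Vec _
    Gⱼ i = G i j

  lincomb-zero : ∀ {k m} (B : Fin k → Vec m) {a : Vec k} → a ≋ zeroVec → lincomb B a ≋ zeroVec
  lincomb-zero B a≋0 j = dot-zeroˡ (λ i → B i j) a≋0

  lincomb-scale : ∀ {k m} (B : Fin k → Vec m) c (a : Vec k) →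
                  lincomb B (scale c a) ≋ scale c (lincomb B a)
  lincomb-scale B c a j =
    trans (Σ-cong (λ i → *-assoc c (a i) (B i j))) (sym (*-distribˡ-Σ c (λ i → a i * B i j)))

  lincomb-injective : ∀ {k m} {B : Fin k → Vec m} → LinIndep B →
                      ∀ {a b} → lincomb B a ≋ lincomb B b → a ≋ b
  lincomb-injective {B = B} indep {a} {b} Ba≋Bb i =
    x∙y⁻¹≈ε⇒x≈y (a i) (b i) (indep (λ t → a t - b t) B[a-b]≋0 i)
    where
    B[a-b]≋0 : lincomb B (λ t → a t - b t) ≋ zeroVec
    B[a-b]≋0 j = begin
      Σ[ (λ t → (a t - b t) * B t j) ]
        ≡⟨ Σ-cong (λ t → [y-z]x≈yx-zx (B t j) (a t) (b t)) ⟩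
      Σ[ (λ t → a t * B t j - b t * B t j) ]
        ≡⟨ Σ-distrib-+ (λ t → a t * B t j) (λ t → - (b t * B t j)) ⟩
      lincomb B a j + Σ[ (λ t → - (b t * B t j)) ]
        ≡⟨ cong (lincomb B a j +_) (Σ-neg (λ t → b t * B t j)) ⟩
      lincomb B a j - lincomb B b j
        ≡⟨ cong (λ y → lincomb B a j - y) (Ba≋Bb j) ⟨
      lincomb B a j - lincomb B a j
        ≡⟨ -‿inverseʳ _ ⟩
      0# ∎

  Member-resp : ∀ {v r} (U : Subspace v r) {x y} → x ≋ y → Member U x → Member U y
  Member-resp U x≋y (a , x≋Ua) = a , ≋-trans (≋-sym x≋y) x≋Ua

  Member-scale : ∀ {v r} (U : Subspace v r) c {x} → Member U x → Member U (scale c x)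
  Member-scale U c (a , x≋Ua) =
    scale c a , λ j → trans (cong (c *_) (x≋Ua j)) (sym (lincomb-scale (Subspace.basis U) c a j))

  SamePoint-sym : ∀ {m} {x y : Vec m} → SamePoint x y → SamePoint y x
  SamePoint-sym {x = x} {y} (c , c≢0 , y≡cx) =
    inv c c≢0 , inv-≢0 c≢0 , λ j → Equivalence.to (*≡⇔≡inv* c≢0 (x j) (y j)) (sym (y≡cx j))

  SamePoint-trans : ∀ {m} {x y z : Vec m} → SamePoint x y → SamePoint y z → SamePoint x z
  SamePoint-trans {x = x} (c , c≢0 , y≡cx) (d , d≢0 , z≡dy) =
    d * c , *-≢0 d≢0 c≢0 ,
    λ j → trans (z≡dy j) (trans (cong (d *_) (y≡cx j)) (sym (*-assoc d c (x j))))

  scale-injectiveˡ : ∀ {m} {y : Vec m} → NonZeroVec y → ∀ {c d} → scale c y ≋ scale d y → c ≡ d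
  scale-injectiveˡ {m} {y} y≉0 {c} {d} cy≋dy
    with Fin.¬∀⟶∃¬ m (λ t → y t ≡ 0#) (λ t → y t ≟ 0#) y≉0
  ... | t , yₜ≢0 = *-cancelˡ-≢0 yₜ≢0 (trans (*-comm (y t) c) (trans (cy≋dy t) (*-comm d (y t))))

  scale-≋0⇔ : ∀ {m} {c} → c ≢ 0# → ∀ {y : Vec m} → scale c y ≋ zeroVec ⇔ y ≋ zeroVec
  scale-≋0⇔ c≢0 = mk⇔ (λ cy≋0 j → Equivalence.to (*-≡0⇔ c≢0) (cy≋0 j))
                      (λ y≋0 j → Equivalence.from (*-≡0⇔ c≢0) (y≋0 j))

  lincomb-≋0⇔ : ∀ {k m} {B : Fin k → Vec m} → LinIndep B →
                ∀ {b} → lincomb B b ≋ zeroVec ⇔ b ≋ zeroVec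
  lincomb-≋0⇔ {B = B} indep {b} = mk⇔ (indep b) (lincomb-zero B)

-- Imported only here: above, _+_ and _*_ are the field operations.
open import Data.Nat using (_+_; _*_)
open import Algebra.Properties.Semiring.Sum +-*-semiring
  using (sum; sum-syntax; sum-cong-≗; ∑-distrib-+; ∑-comm; *-distribˡ-sum; *-distribʳ-sum)

-- Indicators, finite sums and arithmetic in ℕ

𝟙 : {P : Set} → Dec P → ℕ
𝟙 (yes _) = 1
𝟙 (no _)  = 0

𝟙-yes : ∀ {P : Set} (d : Dec P) → P → 𝟙 d ≡ 1
𝟙-yes (yes _) p = refl
𝟙-yes (no ¬p) p = ⊥-elim (¬p p)

𝟙-no : ∀ {P : Set} (d : Dec P) → ¬ P → 𝟙 d ≡ 0
𝟙-no (yes p) ¬p = ⊥-elim (¬p p)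
𝟙-no (no _)  ¬p = refl

𝟙-cong : ∀ {P Q : Set} (d : Dec P) (e : Dec Q) → P ⇔ Q → 𝟙 d ≡ 𝟙 e
𝟙-cong (yes p) e P⇔Q = sym (𝟙-yes e (Equivalence.to P⇔Q p))
𝟙-cong (no ¬p) e P⇔Q = sym (𝟙-no e (λ q → ¬p (Equivalence.from P⇔Q q)))

𝟙-¬?-cong : ∀ {P Q : Set} (d : Dec P) (e : Dec Q) → P ⇔ Q → 𝟙 (¬? d) ≡ 𝟙 (¬? e)
𝟙-¬?-cong d e P⇔Q = 𝟙-cong (¬? d) (¬? e)
  (mk⇔ (λ ¬p q → ¬p (Equivalence.from P⇔Q q)) (λ ¬q p → ¬q (Equivalence.to P⇔Q p)))

𝟙-× : ∀ {P Q : Set} (d : Dec P) (e : Dec Q) → 𝟙 d * 𝟙 e ≡ 𝟙 (d ×-dec e)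
𝟙-× (yes _) (yes _) = refl
𝟙-× (yes _) (no _)  = refl
𝟙-× (no _)  _       = refl

𝟙-¬?+𝟙≡1 : ∀ {P Q : Set} (d : Dec P) (e : Dec Q) → P ⇔ Q → 𝟙 (¬? d) + 𝟙 e ≡ 1
𝟙-¬?+𝟙≡1 (yes p) e P⇔Q = 𝟙-yes e (Equivalence.to P⇔Q p)
𝟙-¬?+𝟙≡1 (no ¬p) e P⇔Q = cong suc (𝟙-no e (λ q → ¬p (Equivalence.from P⇔Q q)))

sum-const : ∀ n k → ∑[ i < n ] k ≡ n * k
sum-const zero    k = refl
sum-const (suc n) k = cong (k +_) (sum-const n k)

sum-zero : ∀ {n} {f : Fin n → ℕ} → (∀ i → f i ≡ 0) → sum f ≡ 0
sum-zero {n} f≡0 = trans (sum-cong-≗ f≡0) (trans (sum-const n 0) (ℕ.*-zeroʳ n))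

sum-mono-≤ : ∀ {n} {f g : Fin n → ℕ} → (∀ i → f i ≤ g i) → sum f ≤ sum g
sum-mono-≤ {zero}  f≤g = z≤n
sum-mono-≤ {suc n} f≤g = ℕ.+-mono-≤ (f≤g zero) (sum-mono-≤ (λ i → f≤g (suc i)))

sum-δ : ∀ {n} (f : Fin n → ℕ) j → ∑[ i < n ] (𝟙 (i Fin.≟ j) * f i) ≡ f j
sum-δ {suc n} f zero =
  trans (cong₂ _+_ (ℕ.*-identityˡ (f zero)) (sum-zero {n} (λ _ → refl))) (ℕ.+-identityʳ _)
sum-δ {suc n} f (suc j) = trans (sum-cong-≗ shift) (sum-δ (λ i → f (suc i)) j)
  where
  shift : ∀ i → 𝟙 (suc i Fin.≟ suc j) * f (suc i) ≡ 𝟙 (i Fin.≟ j) * f (suc i)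
  shift i = cong (_* f (suc i))
                 (𝟙-cong (suc i Fin.≟ suc j) (i Fin.≟ j) (mk⇔ Fin.suc-injective (cong suc)))

sum-𝟙≟ : ∀ {n} (j : Fin n) → ∑[ i < n ] 𝟙 (i Fin.≟ j) ≡ 1
sum-𝟙≟ {n} j = trans (sum-cong-≗ {n} (λ i → sym (ℕ.*-identityʳ _))) (sum-δ (λ _ → 1) j)

m+n≡o⇒m≡o∸n : ∀ m {n o} → m + n ≡ o → m ≡ o ∸ n
m+n≡o⇒m≡o∸n m {n} m+n≡o = trans (sym (ℕ.m+n∸n≡m m n)) (cong (_∸ n) m+n≡o)

^-cancelˡ-≤ : ∀ m {k n} → 1 < m → m ^ k ≤ m ^ n → k ≤ n
^-cancelˡ-≤ m 1<m m^k≤m^n = ℕ.≮⇒≥ (λ n<k → ℕ.<⇒≱ (ℕ.^-monoʳ-< m 1<m n<k) m^k≤m^n)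

m^n∣m^o : ∀ m {n o} → n ≤ o → m ^ n ∣ m ^ o
m^n∣m^o m {n} {o} n≤o =
  divides (m ^ (o ∸ n)) (trans (cong (m ^_) (sym (ℕ.m∸n+n≡m n≤o))) (ℕ.^-distribˡ-+-* m (o ∸ n) n))

q^[r∸1]∣w : ∀ q .{{_ : NonZero q}} {w t r v} → 1 ≤ r → r ≤ v →
            w * q + t * q ^ r ≡ q ^ v → q ^ (r ∸ 1) ∣ w
q^[r∸1]∣w q {w} {t} {suc r} {suc v} _ (s≤s r≤v) wq+tq^r≡q^v =
  ∣m+n∣m⇒∣n (subst (q ^ r ∣_) (trans (sym w+tq^r≡q^v) (ℕ.+-comm w _)) (m^n∣m^o q r≤v))
            (n∣m*n t)
  where
  w+tq^r≡q^v : w + t * q ^ r ≡ q ^ v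
  w+tq^r≡q^v = ℕ.*-cancelˡ-≡ _ _ q (begin
    q * (w + t * q ^ r)         ≡⟨ ℕ.*-distribˡ-+ q w (t * q ^ r) ⟩
    q * w + q * (t * q ^ r)     ≡⟨ cong₂ _+_ (ℕ.*-comm q w) (ℕ*.x∙yz≈y∙xz q t (q ^ r)) ⟩
    w * q + t * (q * q ^ r)     ≡⟨ wq+tq^r≡q^v ⟩
    q * q ^ v                   ∎)
    where open ≡-Reasoning

module Counting {q : ℕ} (F : FiniteField q) where
  open FiniteField F using (Carrier; 0#; _≟_; enumeration)
  private module F = FiniteField F
  open LinearAlgebra F
  open FieldProperties F
  open Vectors F
  open ≡-Reasoning

  enum : Fin q → Carrier
  enum = Inverse.to enumeration

  sumF : (Carrier → ℕ) → ℕ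
  sumF h = ∑[ i < q ] h (enum i)

  sumV : ∀ {m} → (Vec m → ℕ) → ℕ
  sumV {zero}  f = f []
  sumV {suc m} f = sumF (λ c → sumV (λ x → f (c ∷ x)))

  sumV-cong : ∀ {m} {f g : Vec m → ℕ} → (∀ x → f x ≡ g x) → sumV f ≡ sumV g
  sumV-cong {zero}  f≡g = f≡g []
  sumV-cong {suc m} f≡g = sum-cong-≗ {q} (λ i → sumV-cong (λ x → f≡g (enum i ∷ x)))

  sumV-const : ∀ {m} k → sumV {m} (λ _ → k) ≡ q ^ m * k
  sumV-const {zero}  k = sym (ℕ.+-identityʳ k)
  sumV-const {suc m} k = begin
    ∑[ i < q ] sumV {m} (λ _ → k) ≡⟨ sum-cong-≗ {q} (λ _ → sumV-const {m} k) ⟩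
    ∑[ i < q ] (q ^ m * k)        ≡⟨ sum-const q (q ^ m * k) ⟩
    q * (q ^ m * k)               ≡⟨ ℕ.*-assoc q (q ^ m) k ⟨
    q ^ suc m * k                 ∎

  sumV-zero : ∀ {m} {f : Vec m → ℕ} → (∀ x → f x ≡ 0) → sumV f ≡ 0
  sumV-zero {m} f≡0 = trans (sumV-cong f≡0) (trans (sumV-const {m} 0) (ℕ.*-zeroʳ (q ^ m)))

  sumV-distrib-+ : ∀ {m} (f g : Vec m → ℕ) → sumV (λ x → f x + g x) ≡ sumV f + sumV g
  sumV-distrib-+ {zero}  f g = refl
  sumV-distrib-+ {suc m} f g =
    trans (sum-cong-≗ {q} (λ i → sumV-distrib-+ (λ x → f (enum i ∷ x)) (λ x → g (enum i ∷ x))))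
          (∑-distrib-+ (λ i → sumV (λ x → f (enum i ∷ x))) (λ i → sumV (λ x → g (enum i ∷ x))))

  *-distribˡ-sumV : ∀ {m} k (f : Vec m → ℕ) → k * sumV f ≡ sumV (λ x → k * f x)
  *-distribˡ-sumV {zero}  k f = refl
  *-distribˡ-sumV {suc m} k f =
    trans (*-distribˡ-sum k (λ i → sumV (λ x → f (enum i ∷ x))))
          (sum-cong-≗ {q} (λ i → *-distribˡ-sumV k (λ x → f (enum i ∷ x))))

  *-distribʳ-sumV : ∀ {m} k (f : Vec m → ℕ) → sumV f * k ≡ sumV (λ x → f x * k)
  *-distribʳ-sumV k f =
    trans (ℕ.*-comm (sumV f) k) (trans (*-distribˡ-sumV k f) (sumV-cong (λ x → ℕ.*-comm k (f x))))

  sumV-mono-≤ : ∀ {m} {f g : Vec m → ℕ} → (∀ x → f x ≤ g x) → sumV f ≤ sumV g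
  sumV-mono-≤ {zero}  f≤g = f≤g []
  sumV-mono-≤ {suc m} f≤g = sum-mono-≤ (λ i → sumV-mono-≤ (λ x → f≤g (enum i ∷ x)))

  sumV-comm-sum : ∀ {m n} (f : Vec m → Fin n → ℕ) →
                  sumV (λ x → ∑[ j < n ] f x j) ≡ ∑[ j < n ] sumV (λ x → f x j)
  sumV-comm-sum {zero}  f = refl
  sumV-comm-sum {suc m} f =
    trans (sum-cong-≗ {q} (λ i → sumV-comm-sum (λ x → f (enum i ∷ x))))
          (∑-comm (λ i j → sumV (λ x → f (enum i ∷ x) j)))

  sumV-comm : ∀ {m k} (f : Vec m → Vec k → ℕ) →
              sumV (λ x → sumV (λ y → f x y)) ≡ sumV (λ y → sumV (λ x → f x y))
  sumV-comm {zero}  f = refl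
  sumV-comm {suc m} f =
    trans (sum-cong-≗ {q} (λ i → sumV-comm (λ x → f (enum i ∷ x))))
          (sym (sumV-comm-sum (λ y i → sumV (λ x → f (enum i ∷ x) y))))

  enum-≡⇔ : ∀ i d → enum i ≡ d ⇔ i ≡ Inverse.from enumeration d
  enum-≡⇔ i d = mk⇔ (λ e → sym (Inverse.inverseʳ enumeration (sym e)))
                    (λ e → Inverse.inverseˡ enumeration e)

  sumF-δ : ∀ (h : Carrier → ℕ) d → sumF (λ c → 𝟙 (c ≟ d) * h c) ≡ h d
  sumF-δ h d = begin
    ∑[ i < q ] (𝟙 (enum i ≟ d) * h (enum i))
      ≡⟨ sum-cong-≗ {q} (λ i →
           cong (_* h (enum i)) (𝟙-cong (enum i ≟ d) (i Fin.≟ d′) (enum-≡⇔ i d))) ⟩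
    ∑[ i < q ] (𝟙 (i Fin.≟ d′) * h (enum i))
      ≡⟨ sum-δ (λ i → h (enum i)) d′ ⟩
    h (enum d′)
      ≡⟨ cong h (Inverse.strictlyInverseˡ enumeration d) ⟩
    h d ∎
    where
    d′ : Fin q
    d′ = Inverse.from enumeration d

  sumV-δ : ∀ {m} (h : Vec m → ℕ) → h Preserves _≋_ ⟶ _≡_ →
           ∀ y → sumV (λ x → 𝟙 (x ≋? y) * h x) ≡ h y
  sumV-δ {zero}  h h-resp y =
    trans (cong (_* h []) (𝟙-yes ([] ≋? y) (λ ()))) (trans (ℕ.+-identityʳ _) (h-resp (λ ())))
  sumV-δ {suc m} h h-resp y = begin
    sumF (λ c → sumV (λ x → 𝟙 ((c ∷ x) ≋? y) * h (c ∷ x)))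
      ≡⟨ sum-cong-≗ {q} (λ i → sumV-cong (λ x → split (enum i) x)) ⟩
    sumF (λ c → sumV (λ x → 𝟙 (c ≟ head y) * (𝟙 (x ≋? tail y) * h (c ∷ x))))
      ≡⟨ sum-cong-≗ {q} (λ i → *-distribˡ-sumV {m} (𝟙 (enum i ≟ head y))
                                                  (λ x → 𝟙 (x ≋? tail y) * h (enum i ∷ x))) ⟨
    sumF (λ c → 𝟙 (c ≟ head y) * sumV (λ x → 𝟙 (x ≋? tail y) * h (c ∷ x)))
      ≡⟨ sum-cong-≗ {q} (λ i → cong (𝟙 (enum i ≟ head y) *_)
           (sumV-δ (λ x → h (enum i ∷ x)) (λ x≋x′ → h-resp (∷-congʳ x≋x′)) (tail y))) ⟩
    sumF (λ c → 𝟙 (c ≟ head y) * h (c ∷ tail y))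
      ≡⟨ sumF-δ (λ c → h (c ∷ tail y)) (head y) ⟩
    h (head y ∷ tail y)
      ≡⟨ h-resp (head∷tail-≋ y) ⟩
    h y ∎
    where
    split : ∀ c x → 𝟙 ((c ∷ x) ≋? y) * h (c ∷ x)
                  ≡ 𝟙 (c ≟ head y) * (𝟙 (x ≋? tail y) * h (c ∷ x))
    split c x = trans (cong (_* h (c ∷ x)) (trans (𝟙-cong ((c ∷ x) ≋? y) _ (∷-≋⇔ c x y))
                                                  (sym (𝟙-× (c ≟ head y) (x ≋? tail y)))))
                      (ℕ.*-assoc (𝟙 (c ≟ head y)) _ _)

  sumF-𝟙≟ : ∀ d → sumF (λ c → 𝟙 (c ≟ d)) ≡ 1
  sumF-𝟙≟ d = trans (sum-cong-≗ {q} (λ i → sym (ℕ.*-identityʳ _))) (sumF-δ (λ _ → 1) d)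

  sumV-𝟙≋? : ∀ {m} (y : Vec m) → sumV (λ x → 𝟙 (x ≋? y)) ≡ 1
  sumV-𝟙≋? {m} y =
    trans (sumV-cong {m} (λ x → sym (ℕ.*-identityʳ _))) (sumV-δ (λ _ → 1) (λ _ → refl) y)

  ∃? : ∀ {m} {P : Vec m → Set} → P Respects _≋_ → (∀ x → Dec (P x)) → Dec (∃ P)
  ∃? {zero} P-resp P? with P? []
  ... | yes p = yes ([] , p)
  ... | no ¬p = no (λ (x , px) → ¬p (P-resp (λ ()) px))
  ∃? {suc m} {P} P-resp P? =
    map′ (λ (i , x , p) → enum i ∷ x , p) witness
         (Fin.any? (λ i → ∃? (λ x≋x′ → P-resp (∷-congʳ x≋x′)) (λ x → P? (enum i ∷ x))))
    where
    witness : ∃ P → ∃ λ i → ∃ λ x → P (enum i ∷ x)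
    witness (y , py) = Inverse.from enumeration (head y) , tail y , P-resp y≋ py
      where
      y≋ : y ≋ (enum (Inverse.from enumeration (head y)) ∷ tail y)
      y≋ zero    = sym (Inverse.strictlyInverseˡ enumeration (head y))
      y≋ (suc i) = refl

  Member? : ∀ {v r} (U : Subspace v r) x → Dec (Member U x)
  Member? U x = ∃? (λ a≋a′ x≋Ua → ≋-trans x≋Ua (lincomb-cong (Subspace.basis U) a≋a′))
                   (λ a → x ≋? lincomb (Subspace.basis U) a)

  _≢0? : (c : Carrier) → Dec (c ≢ 0#)
  c ≢0? = ¬? (c ≟ 0#)

  nonzero? : ∀ {m} (x : Vec m) → Dec (NonZeroVec x)
  nonzero? x = ¬? (x ≋? zeroVec)

  nonzero-cong : ∀ {m k} {x : Vec m} {y : Vec k} → x ≋ zeroVec ⇔ y ≋ zeroVec →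
                 𝟙 (nonzero? x) ≡ 𝟙 (nonzero? y)
  nonzero-cong {x = x} {y} = 𝟙-¬?-cong (x ≋? zeroVec) (y ≋? zeroVec)

  weight≡sum : ∀ {n} (c : Vec n) → weight c ≡ ∑[ j < n ] 𝟙 (c j ≢0?)
  weight≡sum {zero}  c = refl
  weight≡sum {suc n} c with c zero ≟ 0#
  ... | yes _ = weight≡sum (tail c)
  ... | no _  = cong suc (weight≡sum (tail c))

  weight-cong : ∀ {n} {c c′ : Vec n} → c ≋ c′ → weight c ≡ weight c′
  weight-cong {n} {c} {c′} c≋c′ = begin
    weight c                  ≡⟨ weight≡sum c ⟩
    ∑[ j < n ] 𝟙 (c j ≢0?)   ≡⟨ sum-cong-≗ {n} (λ j → cong (λ t → 𝟙 (t ≢0?)) (c≋c′ j)) ⟩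
    ∑[ j < n ] 𝟙 (c′ j ≢0?)  ≡⟨ weight≡sum c′ ⟨
    weight c′                 ∎

  count-nonzero-unique-root : ∀ (w : Carrier → Carrier) d → (∀ c → w c ≡ 0# ⇔ c ≡ d) →
                              sumF (λ c → 𝟙 (w c ≢0?)) ≡ q ∸ 1
  count-nonzero-unique-root w d root⇔ = m+n≡o⇒m≡o∸n _ (begin
    sumF (λ c → 𝟙 (w c ≢0?)) + 1
      ≡⟨ cong (sumF (λ c → 𝟙 (w c ≢0?)) +_) (sumF-𝟙≟ d) ⟨
    sumF (λ c → 𝟙 (w c ≢0?)) + sumF (λ c → 𝟙 (c ≟ d))
      ≡⟨ ∑-distrib-+ (λ i → 𝟙 (w (enum i) ≢0?)) (λ i → 𝟙 (enum i ≟ d)) ⟨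
    sumF (λ c → 𝟙 (w c ≢0?) + 𝟙 (c ≟ d))
      ≡⟨ sum-cong-≗ {q} (λ i → 𝟙-¬?+𝟙≡1 (w (enum i) ≟ 0#) (enum i ≟ d) (root⇔ (enum i))) ⟩
    sumF (λ _ → 1)
      ≡⟨ sum-const q 1 ⟩
    q * 1
      ≡⟨ ℕ.*-identityʳ q ⟩
    q ∎)

  count-nonzero-scalars : sumF (λ c → 𝟙 (c ≢0?)) ≡ q ∸ 1
  count-nonzero-scalars = count-nonzero-unique-root id 0# (λ _ → mk⇔ id id)

  count-nonzero-affine : ∀ {α} → α ≢ 0# → ∀ β →
                         sumF (λ c → 𝟙 ((α F.* c F.+ β) ≢0?)) ≡ q ∸ 1
  count-nonzero-affine α≢0 β = count-nonzero-unique-root _ (proj₁ root) (proj₂ root)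
    where root = affine-root α≢0 β

  count-nonzero-vectors : ∀ m → sumV {m} (λ x → 𝟙 (nonzero? x)) ≡ q ^ m ∸ 1
  count-nonzero-vectors m = m+n≡o⇒m≡o∸n _ (begin
    sumV #≠0 + 1
      ≡⟨ cong (sumV #≠0 +_) (sumV-𝟙≋? {m} zeroVec) ⟨
    sumV #≠0 + sumV #=0
      ≡⟨ sumV-distrib-+ #≠0 #=0 ⟨
    sumV (λ x → #≠0 x + #=0 x)
      ≡⟨ sumV-cong {m} (λ x → 𝟙-¬?+𝟙≡1 (x ≋? zeroVec) (x ≋? zeroVec) (mk⇔ id id)) ⟩
    sumV {m} (λ _ → 1)
      ≡⟨ sumV-const {m} 1 ⟩
    q ^ m * 1
      ≡⟨ ℕ.*-identityʳ (q ^ m) ⟩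
    q ^ m ∎)
    where
    #≠0 : Vec m → ℕ
    #≠0 x = 𝟙 (nonzero? x)
    #=0 : Vec m → ℕ
    #=0 x = 𝟙 (x ≋? zeroVec)

  count-dot-head≢0 : ∀ {m} (a : Vec (suc m)) → head a ≢ 0# →
                     sumV (λ x → 𝟙 (dot a x ≢0?)) ≡ (q ∸ 1) * q ^ m
  count-dot-head≢0 {m} a a₀≢0 = begin
    sumF (λ c → sumV (λ x → 𝟙 ((head a F.* c F.+ dot (tail a) x) ≢0?)))
      ≡⟨ sumV-comm-sum (λ x i → 𝟙 ((head a F.* enum i F.+ dot (tail a) x) ≢0?)) ⟨
    sumV (λ x → sumF (λ c → 𝟙 ((head a F.* c F.+ dot (tail a) x) ≢0?)))
      ≡⟨ sumV-cong (λ x → count-nonzero-affine a₀≢0 (dot (tail a) x)) ⟩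
    sumV {m} (λ _ → q ∸ 1)
      ≡⟨ sumV-const {m} (q ∸ 1) ⟩
    q ^ m * (q ∸ 1)
      ≡⟨ ℕ.*-comm (q ^ m) (q ∸ 1) ⟩
    (q ∸ 1) * q ^ m ∎

  count-dot-head≡0 : ∀ {m} (a : Vec (suc m)) → head a ≡ 0# →
                     sumV (λ x → 𝟙 (dot a x ≢0?)) ≡ q * sumV (λ x → 𝟙 (dot (tail a) x ≢0?))
  count-dot-head≡0 {m} a a₀≡0 =
    trans (sum-cong-≗ {q} (λ i → sumV-cong (λ x →
            cong (λ t → 𝟙 (t ≢0?)) (a₀c+d≡d (enum i) (dot (tail a) x)))))
          (sum-const q (sumV (λ x → 𝟙 (dot (tail a) x ≢0?))))
    where
    a₀c+d≡d : ∀ c d → head a F.* c F.+ d ≡ d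
    a₀c+d≡d c d = trans (cong (F._+ d) (trans (cong (F._* c) a₀≡0) (zeroˡ c))) (F.+-identityˡ d)

  -- Multiplied by q, so that no q ^ (m ∸ 1) appears.
  count-nonzero-dot : ∀ {m} (a : Vec m) →
                      sumV (λ x → 𝟙 (dot a x ≢0?)) * q ≡ 𝟙 (nonzero? a) * ((q ∸ 1) * q ^ m)
  count-nonzero-dot {zero}  a =
    trans (cong (_* q) (𝟙-no (0# ≢0?) (λ 0≢0 → 0≢0 refl)))
          (sym (cong (_* ((q ∸ 1) * 1)) (𝟙-no (nonzero? a) (λ a≉0 → a≉0 (λ ())))))
  count-nonzero-dot {suc m} a = by-head (head a ≟ 0#)
    where
    by-head : Dec (head a ≡ 0#) →
              sumV (λ x → 𝟙 (dot a x ≢0?)) * q ≡ 𝟙 (nonzero? a) * ((q ∸ 1) * q ^ suc m)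
    by-head (no a₀≢0) = begin
      sumV (λ x → 𝟙 (dot a x ≢0?)) * q
        ≡⟨ cong (_* q) (count-dot-head≢0 a a₀≢0) ⟩
      (q ∸ 1) * q ^ m * q
        ≡⟨ ℕ*.xy∙z≈x∙zy (q ∸ 1) (q ^ m) q ⟩
      (q ∸ 1) * q ^ suc m
        ≡⟨ ℕ.*-identityˡ _ ⟨
      1 * ((q ∸ 1) * q ^ suc m)
        ≡⟨ cong (_* ((q ∸ 1) * q ^ suc m)) (𝟙-yes (nonzero? a) a≉0) ⟨
      𝟙 (nonzero? a) * ((q ∸ 1) * q ^ suc m) ∎
      where
      a≉0 : NonZeroVec a
      a≉0 a≋0 = a₀≢0 (a≋0 zero)
    by-head (yes a₀≡0) = begin
      sumV (λ x → 𝟙 (dot a x ≢0?)) * q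
        ≡⟨ cong (_* q) (count-dot-head≡0 a a₀≡0) ⟩
      q * sumV (λ x → 𝟙 (dot a′ x ≢0?)) * q
        ≡⟨ ℕ.*-assoc q _ q ⟩
      q * (sumV (λ x → 𝟙 (dot a′ x ≢0?)) * q)
        ≡⟨ cong (q *_) (count-nonzero-dot a′) ⟩
      q * (𝟙 (nonzero? a′) * ((q ∸ 1) * q ^ m))
        ≡⟨ cong (λ t → q * (t * ((q ∸ 1) * q ^ m)))
                (𝟙-cong (nonzero? a′) (nonzero? a) a′≉0⇔a≉0) ⟩
      q * (𝟙 (nonzero? a) * ((q ∸ 1) * q ^ m))
        ≡⟨ ℕ*.x∙yz≈y∙xz q (𝟙 (nonzero? a)) _ ⟩
      𝟙 (nonzero? a) * (q * ((q ∸ 1) * q ^ m))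
        ≡⟨ cong (𝟙 (nonzero? a) *_) (ℕ*.x∙yz≈y∙xz q (q ∸ 1) (q ^ m)) ⟩
      𝟙 (nonzero? a) * ((q ∸ 1) * q ^ suc m) ∎
      where
      a′ : Vec m
      a′ = tail a
      a′≉0⇔a≉0 : NonZeroVec a′ ⇔ NonZeroVec a
      a′≉0⇔a≉0 = mk⇔ (λ a′≉0 a≋0 → a′≉0 (λ i → a≋0 (suc i)))
                     (λ a≉0 a′≋0 → a≉0 (λ { zero → a₀≡0 ; (suc i) → a′≋0 i }))

  sumV-fibres : ∀ {k m} (ψ : Vec k → Vec m) → sumV (λ x → sumV (λ b → 𝟙 (x ≋? ψ b))) ≡ q ^ k
  sumV-fibres {k} ψ = begin
    sumV (λ x → sumV (λ b → 𝟙 (x ≋? ψ b))) ≡⟨ sumV-comm (λ x b → 𝟙 (x ≋? ψ b)) ⟩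
    sumV (λ b → sumV (λ x → 𝟙 (x ≋? ψ b))) ≡⟨ sumV-cong (λ b → sumV-𝟙≋? (ψ b)) ⟩
    sumV {k} (λ _ → 1)                      ≡⟨ sumV-const {k} 1 ⟩
    q ^ k * 1                               ≡⟨ ℕ.*-identityʳ (q ^ k) ⟩
    q ^ k                                   ∎

  module _ {k m} {ψ : Vec k → Vec m} (ψ-cong : ψ Preserves _≋_ ⟶ _≋_)
           (ψ-injective : ∀ {b b′} → ψ b ≋ ψ b′ → b ≋ b′) where

    fibre≡1 : ∀ {x b₀} → x ≋ ψ b₀ → sumV (λ b → 𝟙 (x ≋? ψ b)) ≡ 1
    fibre≡1 {x} {b₀} x≋ψb₀ =
      trans (sumV-cong (λ b → 𝟙-cong (x ≋? ψ b) (b ≋? b₀) x≋ψb⇔b≋b₀)) (sumV-𝟙≋? b₀)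
      where
      x≋ψb⇔b≋b₀ : ∀ {b} → x ≋ ψ b ⇔ b ≋ b₀
      x≋ψb⇔b≋b₀ = mk⇔ (λ x≋ψb → ψ-injective (≋-trans (≋-sym x≋ψb) x≋ψb₀))
                      (λ b≋b₀ → ≋-trans x≋ψb₀ (≋-sym (ψ-cong b≋b₀)))

    fibre≤1 : ∀ x → sumV (λ b → 𝟙 (x ≋? ψ b)) ≤ 1
    fibre≤1 x with ∃? (λ b≋b′ x≋ψb → ≋-trans x≋ψb (ψ-cong b≋b′)) (λ b → x ≋? ψ b)
    ... | yes (b₀ , x≋ψb₀) = ℕ.≤-reflexive (fibre≡1 x≋ψb₀)
    ... | no ∄b =
      subst (_≤ 1) (sym (sumV-zero (λ b → 𝟙-no (x ≋? ψ b) (λ x≋ψb → ∄b (b , x≋ψb))))) z≤n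

    injective⇒q^k≤q^m : q ^ k ≤ q ^ m
    injective⇒q^k≤q^m = subst₂ _≤_ (sumV-fibres ψ) (trans (sumV-const {m} 1) (ℕ.*-identityʳ _))
                                   (sumV-mono-≤ fibre≤1)

  HasDimension⇒≤ : ∀ {v n k} (G : Matrix v n) → HasDimension G k → k ≤ v
  HasDimension⇒≤ {v} {n} {k} G (B , B∈C , B-indep , _) =
    ^-cancelˡ-≤ q 2≤q (injective⇒q^k≤q^m (lincomb-cong A) ψ-injective)
    where
    A : Fin k → Vec v
    A t = proj₁ (B∈C t)

    GA≋B : ∀ b → lincomb G (lincomb A b) ≋ lincomb B b
    GA≋B b = ≋-trans (lincomb-lincomb G A b) (lincomb-congˡ (λ t → ≋-sym (proj₂ (B∈C t))) b)

    ψ-injective : ∀ {b b′} → lincomb A b ≋ lincomb A b′ → b ≋ b′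
    ψ-injective {b} {b′} Ab≋Ab′ =
      lincomb-injective B-indep (≋-trans (≋-sym (GA≋B b)) (≋-trans (lincomb-cong G Ab≋Ab′) (GA≋B b′)))

module HoleCode {q : ℕ} (F : FiniteField q) {v r s n : ℕ}
                (S : LinearAlgebra.PartialSpread F v r s) (G : LinearAlgebra.Matrix F v n)
                (assoc : LinearAlgebra.AssociatedWithHoles F S G) where
  open FiniteField F using (Carrier; 0#; _≟_)
  open LinearAlgebra F
  open FieldProperties F using (zeroʳ; *-≡0⇔; q-nonZero; q∸1-nonZero)
  private module F = FiniteField F
  open Vectors F
  open Counting F
  open PartialSpread S
  open ≡-Reasoning

  col : Fin n → Vec v
  col = column G

  φ : Fin s → Vec r → Vec v
  φ i = lincomb (Subspace.basis (member i))

  col-hole : ∀ j → IsHole S (col j)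
  col-hole = proj₁ assoc

  hole-covered : ∀ x → IsHole S x → ∃ λ j → SamePoint (col j) x
  hole-covered = proj₁ (proj₂ assoc)

  col-distinct : ∀ j j′ → SamePoint (col j) (col j′) → j ≡ j′
  col-distinct = proj₂ (proj₂ assoc)

  φ-injective : ∀ i {b b′} → φ i b ≋ φ i b′ → b ≋ b′
  φ-injective i = lincomb-injective (Subspace.indep (member i))

  holeMultiplicity : Vec v → ℕ
  holeMultiplicity x = ∑[ j < n ] sumF (λ c → 𝟙 (c ≢0?) * 𝟙 (x ≋? scale c (col j)))

  spreadMultiplicity : Vec v → ℕ
  spreadMultiplicity x = ∑[ i < s ] sumV (λ b → 𝟙 (x ≋? φ i b))

  holeMultiplicity-hole : ∀ {x} → IsHole S x → holeMultiplicity x ≡ 1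
  holeMultiplicity-hole {x} x-hole with hole-covered x x-hole
  ... | j₀ , c₀ , c₀≢0 , x≋c₀colj₀ = trans (sum-cong-≗ {n} column-term) (sum-𝟙≟ j₀)
    where
    x~colj₀ : SamePoint x (col j₀)
    x~colj₀ = SamePoint-sym (c₀ , c₀≢0 , x≋c₀colj₀)

    scalar⇔ : ∀ c → (c ≢ 0# × x ≋ scale c (col j₀)) ⇔ c ≡ c₀
    scalar⇔ c = mk⇔
      (λ (_ , x≋ccolj₀) → scale-injectiveˡ (proj₁ (col-hole j₀)) (≋-trans (≋-sym x≋ccolj₀) x≋c₀colj₀))
      (λ { refl → c₀≢0 , x≋c₀colj₀ })

    column-term : ∀ j → sumF (λ c → 𝟙 (c ≢0?) * 𝟙 (x ≋? scale c (col j))) ≡ 𝟙 (j Fin.≟ j₀)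
    column-term j with j Fin.≟ j₀
    ... | yes refl = trans (sum-cong-≗ {q} (λ i →
                       trans (𝟙-× (enum i ≢0?) (x ≋? scale (enum i) (col j₀)))
                             (𝟙-cong _ (enum i ≟ c₀) (scalar⇔ (enum i)))))
                     (sumF-𝟙≟ c₀)
    ... | no j≢j₀ = sum-zero (λ i →
                      trans (𝟙-× (enum i ≢0?) (x ≋? scale (enum i) (col j)))
                            (𝟙-no _ (λ (c≢0 , x≋ccolj) → j≢j₀ (col-distinct j j₀
                              (SamePoint-trans (_ , c≢0 , x≋ccolj) x~colj₀)))))

  holeMultiplicity-member : ∀ {x i} → Member (member i) x → holeMultiplicity x ≡ 0
  holeMultiplicity-member {x} {i} x∈Uᵢ =
    sum-zero (λ j → sum-zero (λ t → trans (𝟙-× (enum t ≢0?) (x ≋? scale (enum t) (col j)))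
      (𝟙-no _ (λ (c≢0 , x≋ccolj) → proj₂ (col-hole j) i (col∈Uᵢ j (_ , c≢0 , x≋ccolj))))))
    where
    col∈Uᵢ : ∀ j → SamePoint (col j) x → Member (member i) (col j)
    col∈Uᵢ j colj~x with SamePoint-sym colj~x
    ... | d , _ , colj≋dx = Member-resp (member i) (≋-sym colj≋dx) (Member-scale (member i) d x∈Uᵢ)

  spreadMultiplicity-member : ∀ {x i₀} → NonZeroVec x → Member (member i₀) x →
                              spreadMultiplicity x ≡ 1
  spreadMultiplicity-member {x} {i₀} x≉0 (b₀ , x≋φb₀) =
    trans (sum-cong-≗ {s} member-term) (sum-𝟙≟ i₀)
    where
    member-term : ∀ i → sumV (λ b → 𝟙 (x ≋? φ i b)) ≡ 𝟙 (i Fin.≟ i₀)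
    member-term i with i Fin.≟ i₀
    ... | yes refl = fibre≡1 (lincomb-cong _) (φ-injective i₀) x≋φb₀
    ... | no i≢i₀  = sumV-zero (λ b → 𝟙-no (x ≋? φ i b)
                       (λ x≋φb → x≉0 (disjoint i i₀ i≢i₀ x (b , x≋φb) (b₀ , x≋φb₀))))

  spreadMultiplicity-nonmember : ∀ {x} → (∀ i → ¬ Member (member i) x) → spreadMultiplicity x ≡ 0
  spreadMultiplicity-nonmember {x} x∉S =
    sum-zero (λ i → sumV-zero (λ b → 𝟙-no (x ≋? φ i b) (λ x≋φb → x∉S i (b , x≋φb))))

  multiplicity≡1 : ∀ {x} → NonZeroVec x → holeMultiplicity x + spreadMultiplicity x ≡ 1
  multiplicity≡1 {x} x≉0 with Fin.any? (λ i → Member? (member i) x)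
  ... | yes (i , x∈Uᵢ) =
    cong₂ _+_ (holeMultiplicity-member x∈Uᵢ) (spreadMultiplicity-member x≉0 x∈Uᵢ)
  ... | no x∉S =
    cong₂ _+_ (holeMultiplicity-hole (x≉0 , x∉Uᵢ)) (spreadMultiplicity-nonmember x∉Uᵢ)
    where
    x∉Uᵢ : ∀ i → ¬ Member (member i) x
    x∉Uᵢ i x∈Uᵢ = x∉S (i , x∈Uᵢ)

  module _ (g : Vec v → ℕ) (g-cong : g Preserves _≋_ ⟶ _≡_) where

    sumV-holeMultiplicity : (∀ c y → c ≢ 0# → g (scale c y) ≡ g y) →
                            sumV (λ x → holeMultiplicity x * g x) ≡ (q ∸ 1) * ∑[ j < n ] g (col j)
    sumV-holeMultiplicity g-scale = begin
      sumV (λ x → holeMultiplicity x * g x)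
        ≡⟨ sumV-cong distribute ⟩
      sumV (λ x → ∑[ j < n ] sumF (λ c → 𝟙 (c ≢0?) * (𝟙 (x ≋? scale c (col j)) * g x)))
        ≡⟨ sumV-comm-sum (λ x j → sumF (λ c → 𝟙 (c ≢0?) * (𝟙 (x ≋? scale c (col j)) * g x))) ⟩
      ∑[ j < n ] sumV (λ x → sumF (λ c → 𝟙 (c ≢0?) * (𝟙 (x ≋? scale c (col j)) * g x)))
        ≡⟨ sum-cong-≗ {n} (λ j → sumV-comm-sum (λ x i →
             𝟙 (enum i ≢0?) * (𝟙 (x ≋? scale (enum i) (col j)) * g x))) ⟩
      ∑[ j < n ] sumF (λ c → sumV (λ x → 𝟙 (c ≢0?) * (𝟙 (x ≋? scale c (col j)) * g x)))
        ≡⟨ sum-cong-≗ {n} (λ j → sum-cong-≗ {q} (λ i → pushforward (enum i) (col j))) ⟩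
      ∑[ j < n ] sumF (λ c → 𝟙 (c ≢0?) * g (scale c (col j)))
        ≡⟨ sum-cong-≗ {n} (λ j → sum-cong-≗ {q} (λ i → scaled (enum i) (col j))) ⟩
      ∑[ j < n ] sumF (λ c → 𝟙 (c ≢0?) * g (col j))
        ≡⟨ sum-cong-≗ {n} (λ j → trans (sym (*-distribʳ-sum (g (col j)) (λ i → 𝟙 (enum i ≢0?))))
                                        (cong (_* g (col j)) count-nonzero-scalars)) ⟩
      ∑[ j < n ] ((q ∸ 1) * g (col j))
        ≡⟨ *-distribˡ-sum (q ∸ 1) (λ j → g (col j)) ⟨
      (q ∸ 1) * ∑[ j < n ] g (col j) ∎
      where
      distribute : ∀ x → holeMultiplicity x * g x
                       ≡ ∑[ j < n ] sumF (λ c → 𝟙 (c ≢0?) * (𝟙 (x ≋? scale c (col j)) * g x))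
      distribute x =
        trans (*-distribʳ-sum (g x) (λ j → sumF (λ c → 𝟙 (c ≢0?) * 𝟙 (x ≋? scale c (col j)))))
              (sum-cong-≗ {n} (λ j →
                trans (*-distribʳ-sum (g x) (λ i → 𝟙 (enum i ≢0?) * 𝟙 (x ≋? scale (enum i) (col j))))
                      (sum-cong-≗ {q} (λ i → ℕ.*-assoc (𝟙 (enum i ≢0?)) _ (g x)))))

      pushforward : ∀ c y → sumV (λ x → 𝟙 (c ≢0?) * (𝟙 (x ≋? scale c y) * g x))
                          ≡ 𝟙 (c ≢0?) * g (scale c y)
      pushforward c y = trans (sym (*-distribˡ-sumV (𝟙 (c ≢0?)) (λ x → 𝟙 (x ≋? scale c y) * g x)))
                              (cong (𝟙 (c ≢0?) *_) (sumV-δ g g-cong (scale c y)))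

      scaled : ∀ c y → 𝟙 (c ≢0?) * g (scale c y) ≡ 𝟙 (c ≢0?) * g y
      scaled c y with c ≟ 0#
      ... | yes _   = refl
      ... | no c≢0 = cong (_+ 0) (g-scale c y c≢0)

    sumV-spreadMultiplicity :
      sumV (λ x → spreadMultiplicity x * g x) ≡ ∑[ i < s ] sumV (λ b → g (φ i b))
    sumV-spreadMultiplicity = begin
      sumV (λ x → spreadMultiplicity x * g x)
        ≡⟨ sumV-cong (λ x →
             trans (*-distribʳ-sum (g x) (λ i → sumV (λ b → 𝟙 (x ≋? φ i b))))
                   (sum-cong-≗ {s} (λ i → *-distribʳ-sumV {r} (g x) (λ b → 𝟙 (x ≋? φ i b))))) ⟩
      sumV (λ x → ∑[ i < s ] sumV (λ b → 𝟙 (x ≋? φ i b) * g x))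
        ≡⟨ sumV-comm-sum (λ x i → sumV (λ b → 𝟙 (x ≋? φ i b) * g x)) ⟩
      ∑[ i < s ] sumV (λ x → sumV (λ b → 𝟙 (x ≋? φ i b) * g x))
        ≡⟨ sum-cong-≗ {s} (λ i → sumV-comm (λ x b → 𝟙 (x ≋? φ i b) * g x)) ⟩
      ∑[ i < s ] sumV (λ b → sumV (λ x → 𝟙 (x ≋? φ i b) * g x))
        ≡⟨ sum-cong-≗ {s} (λ i → sumV-cong (λ b → sumV-δ g g-cong (φ i b))) ⟩
      ∑[ i < s ] sumV (λ b → g (φ i b)) ∎

    sumV-split : g zeroVec ≡ 0 → (∀ c y → c ≢ 0# → g (scale c y) ≡ g y) →
                 sumV g ≡ (q ∸ 1) * ∑[ j < n ] g (col j) + ∑[ i < s ] sumV (λ b → g (φ i b))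
    sumV-split g0≡0 g-scale = begin
      sumV g
        ≡⟨ sumV-cong (λ x → weigh x (x ≋? zeroVec)) ⟩
      sumV (λ x → holeMultiplicity x * g x + spreadMultiplicity x * g x)
        ≡⟨ sumV-distrib-+ (λ x → holeMultiplicity x * g x) (λ x → spreadMultiplicity x * g x) ⟩
      sumV (λ x → holeMultiplicity x * g x) + sumV (λ x → spreadMultiplicity x * g x)
        ≡⟨ cong₂ _+_ (sumV-holeMultiplicity g-scale) sumV-spreadMultiplicity ⟩
      (q ∸ 1) * ∑[ j < n ] g (col j) + ∑[ i < s ] sumV (λ b → g (φ i b)) ∎
      where
      weigh : ∀ x → Dec (x ≋ zeroVec) → g x ≡ holeMultiplicity x * g x + spreadMultiplicity x * g x
      weigh x (yes x≋0) = begin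
        g x
          ≡⟨ gx≡0 ⟩
        0
          ≡⟨ cong₂ _+_ (ℕ.*-zeroʳ (holeMultiplicity x)) (ℕ.*-zeroʳ (spreadMultiplicity x)) ⟨
        holeMultiplicity x * 0 + spreadMultiplicity x * 0
          ≡⟨ cong (λ t → holeMultiplicity x * t + spreadMultiplicity x * t) gx≡0 ⟨
        holeMultiplicity x * g x + spreadMultiplicity x * g x ∎
        where
        gx≡0 : g x ≡ 0
        gx≡0 = trans (g-cong x≋0) g0≡0
      weigh x (no x≉0) = begin
        g x
          ≡⟨ ℕ.*-identityˡ (g x) ⟨
        1 * g x
          ≡⟨ cong (_* g x) (multiplicity≡1 x≉0) ⟨
        (holeMultiplicity x + spreadMultiplicity x) * g x
          ≡⟨ ℕ.*-distribʳ-+ (g x) (holeMultiplicity x) _ ⟩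
        holeMultiplicity x * g x + spreadMultiplicity x * g x ∎

  hole-count : n * (q ∸ 1) + s * (q ^ r ∸ 1) ≡ q ^ v ∸ 1
  hole-count = begin
    n * (q ∸ 1) + s * (q ^ r ∸ 1)
      ≡⟨ cong₂ _+_ (ℕ.*-comm n (q ∸ 1)) (sym (sum-const s (q ^ r ∸ 1))) ⟩
    (q ∸ 1) * n + ∑[ i < s ] (q ^ r ∸ 1)
      ≡⟨ cong₂ (λ a b → (q ∸ 1) * a + b) columns-nonzero spread-nonzero ⟨
    (q ∸ 1) * ∑[ j < n ] 𝟙 (nonzero? (col j)) + ∑[ i < s ] sumV (λ b → 𝟙 (nonzero? (φ i b)))
      ≡⟨ sumV-split (λ x → 𝟙 (nonzero? x)) (λ x≋y → nonzero-cong (≋-zero⇔ x≋y))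
                    (𝟙-no (nonzero? zeroVec) (λ 0≉0 → 0≉0 (λ _ → refl)))
                    (λ c y c≢0 → nonzero-cong (scale-≋0⇔ c≢0)) ⟨
    sumV {v} (λ x → 𝟙 (nonzero? x))
      ≡⟨ count-nonzero-vectors v ⟩
    q ^ v ∸ 1 ∎
    where
    columns-nonzero : ∑[ j < n ] 𝟙 (nonzero? (col j)) ≡ n
    columns-nonzero = begin
      ∑[ j < n ] 𝟙 (nonzero? (col j))
        ≡⟨ sum-cong-≗ {n} (λ j → 𝟙-yes (nonzero? (col j)) (proj₁ (col-hole j))) ⟩
      ∑[ j < n ] 1
        ≡⟨ sum-const n 1 ⟩
      n * 1
        ≡⟨ ℕ.*-identityʳ n ⟩
      n ∎

    spread-nonzero : ∑[ i < s ] sumV (λ b → 𝟙 (nonzero? (φ i b))) ≡ ∑[ i < s ] (q ^ r ∸ 1)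
    spread-nonzero = sum-cong-≗ {s} (λ i →
      trans (sumV-cong {r} (λ b →
              nonzero-cong {x = φ i b} (lincomb-≋0⇔ (Subspace.indep (member i)))))
            (count-nonzero-vectors r))

  restrict : Vec v → Fin s → Vec r
  restrict a i t = dot a (Subspace.basis (member i) t)

  nonvanishingMembers : Vec v → ℕ
  nonvanishingMembers a = ∑[ i < s ] 𝟙 (nonzero? (restrict a i))

  codeword-count : ∀ a → sumV (λ x → 𝟙 (dot a x ≢0?))
                       ≡ (q ∸ 1) * weight (lincomb G a)
                         + ∑[ i < s ] sumV (λ b → 𝟙 (dot (restrict a i) b ≢0?))
  codeword-count a = trans
    (sumV-split (λ x → 𝟙 (dot a x ≢0?)) (λ x≋y → cong (λ t → 𝟙 (t ≢0?)) (dot-congʳ a x≋y))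
                (𝟙-no (dot a zeroVec ≢0?) (λ a0≢0 → a0≢0 (dot-zeroʳ a (λ _ → refl))))
                scale-invariant)
    (cong₂ (λ w t → (q ∸ 1) * w + t) (sym (weight≡sum (lincomb G a)))
           (sum-cong-≗ {s} (λ i → sumV-cong {r} (λ b →
              cong (λ t → 𝟙 (t ≢0?)) (dot-lincomb a _ b)))))
    where
    scale-invariant : ∀ c y → c ≢ 0# → 𝟙 (dot a (scale c y) ≢0?) ≡ 𝟙 (dot a y ≢0?)
    scale-invariant c y c≢0 = trans (cong (λ t → 𝟙 (t ≢0?)) (dot-scaleʳ a y c))
                                    (𝟙-¬?-cong ((c F.* dot a y) ≟ 0#) (dot a y ≟ 0#) (*-≡0⇔ c≢0))

  weight-equation : ∀ a → NonZeroVec a →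
                    weight (lincomb G a) * q + nonvanishingMembers a * q ^ r ≡ q ^ v
  weight-equation a a≉0 = ℕ.*-cancelˡ-≡ _ _ (q ∸ 1) {{q∸1-nonZero}} (begin
    (q ∸ 1) * (W * q + T * q ^ r)
      ≡⟨ ℕ.*-distribˡ-+ (q ∸ 1) (W * q) (T * q ^ r) ⟩
    (q ∸ 1) * (W * q) + (q ∸ 1) * (T * q ^ r)
      ≡⟨ cong₂ _+_ (sym (ℕ.*-assoc (q ∸ 1) W q)) (ℕ*.x∙yz≈y∙xz (q ∸ 1) T (q ^ r)) ⟩
    (q ∸ 1) * W * q + T * ((q ∸ 1) * q ^ r)
      ≡⟨ cong ((q ∸ 1) * W * q +_) (*-distribʳ-sum ((q ∸ 1) * q ^ r) (λ i → 𝟙 (nonzero? (restrict a i)))) ⟩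
    (q ∸ 1) * W * q + ∑[ i < s ] (𝟙 (nonzero? (restrict a i)) * ((q ∸ 1) * q ^ r))
      ≡⟨ cong ((q ∸ 1) * W * q +_) (sum-cong-≗ {s} (λ i → count-nonzero-dot (restrict a i))) ⟨
    (q ∸ 1) * W * q + ∑[ i < s ] (restricted-count i * q)
      ≡⟨ cong ((q ∸ 1) * W * q +_) (*-distribʳ-sum q restricted-count) ⟨
    (q ∸ 1) * W * q + (∑[ i < s ] restricted-count i) * q
      ≡⟨ ℕ.*-distribʳ-+ q ((q ∸ 1) * W) _ ⟨
    ((q ∸ 1) * W + ∑[ i < s ] restricted-count i) * q
      ≡⟨ cong (_* q) (codeword-count a) ⟨
    sumV (λ x → 𝟙 (dot a x ≢0?)) * q
      ≡⟨ count-nonzero-dot a ⟩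
    𝟙 (nonzero? a) * ((q ∸ 1) * q ^ v)
      ≡⟨ cong (_* ((q ∸ 1) * q ^ v)) (𝟙-yes (nonzero? a) a≉0) ⟩
    1 * ((q ∸ 1) * q ^ v)
      ≡⟨ ℕ.*-identityˡ _ ⟩
    (q ∸ 1) * q ^ v ∎)
    where
    W T : ℕ
    W = weight (lincomb G a)
    T = nonvanishingMembers a
    restricted-count : Fin s → ℕ
    restricted-count i = sumV (λ b → 𝟙 (dot (restrict a i) b ≢0?))

  weight-divisible : 1 ≤ r → r ≤ v → ∀ a → q ^ (r ∸ 1) ∣ weight (lincomb G a)
  weight-divisible 1≤r r≤v a with a ≋? zeroVec
  ... | no a≉0 = q^[r∸1]∣w q {{q-nonZero}} {t = nonvanishingMembers a} 1≤r r≤v (weight-equation a a≉0)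
  ... | yes a≋0 = subst (q ^ (r ∸ 1) ∣_) (sym weight≡0) ((q ^ (r ∸ 1)) ∣0)
    where
    weight≡0 : weight (lincomb G a) ≡ 0
    weight≡0 = trans (weight≡sum (lincomb G a))
                     (sum-zero (λ j → 𝟙-no (lincomb G a j ≢0?) (λ ≢0 → ≢0 (lincomb-zero G a≋0 j))))

proposition1 : (q : ℕ) (F : FiniteField q) (v r s : ℕ) → 2 ≤ r → r ≤ v →
    (S : LinearAlgebra.PartialSpread F v r s) →
    (n : ℕ) (G : LinearAlgebra.Matrix F v n) →
    LinearAlgebra.AssociatedWithHoles F S G →
      (LinearAlgebra.Projective F G × LinearAlgebra.Divisible F (q ^ (r ∸ 1)) G)
    × ((n * (q ∸ 1) + s * (q ^ r ∸ 1) ≡ q ^ v ∸ 1)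
    × ((k : ℕ) → LinearAlgebra.HasDimension F G k → k ≤ v))
proposition1 q F v r s 2≤r r≤v S n G assoc =
  (projective , divisible) , hole-count , λ k → HasDimension⇒≤ G
  where
  open LinearAlgebra F
  open Vectors F using (≋-sym)
  open Counting F using (weight-cong; HasDimension⇒≤)
  open HoleCode F S G assoc

  projective : Projective G
  projective = (λ j → proj₁ (col-hole j)) , (λ j j′ j≢j′ same → j≢j′ (col-distinct j j′ same))

  divisible : Divisible (q ^ (r ∸ 1)) G
  divisible c (a , c≋Ga) =
    subst (q ^ (r ∸ 1) ∣_) (weight-cong (≋-sym c≋Ga)) (weight-divisible (ℕ.≤-trans (s≤s z≤n) 2≤r) r≤v a)
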